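{- Let $r,k$ be coprime integers with $1\le k<r/3$, and let $\{0,k\}\subseteq A\subseteq[0,k]\subseteq\mathbb{Z}/r\mathbb{Z}$. Then for every $w\in\mathbb{Z}/r\mathbb{Z}$ there exists $S_0\subseteq\mathbb{Z}/r\mathbb{Z}$ with $|S_0|\ge2$ and $w+k\in S_0$ such that $(w,w+k,S_0)$ is a pointed minimal cover.
   Context: For integers $a\le b$, $[a,b]=\{\overline a,\overline{a+1},\dots,\overline b\}\subseteq\mathbb{Z}/r\mathbb{Z}$. For $w\in\mathbb{Z}/r\mathbb{Z}$, $A+w=\{a+w\mid a\in A\}$. A triple $(w_0,w_1,S_0)$ with $w_0,w_1\in\mathbb{Z}/r\mathbb{Z}$, $S_0\subseteq\mathbb{Z}/r\mathbb{Z}$, $|S_0|\ge2$, $w_1\in S_0$ is a pointed minimal cover if (Minimality) for all $S_1\subseteq S_0$, $A+w_0\subseteq\bigcup_{s\in S_1}(A+s)$ iff $S_1=S_0$; and (Irreducibility) $A+w_1\not\subseteq\bigcup_{w\in(S_0\setminus\{w_1\})\cup\{w_0\}}(A+w)$. -}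

module Defs where

open import Data.Nat using (ℕ; _+_; _≤_; NonZero)
open import Data.Nat.DivMod using (_mod_)
open import Data.Fin using (Fin; toℕ)
open import Data.Fin.Subset using (Subset; _∈_; _⊆_; ∣_∣)
open import Data.Product using (∃; _×_; _,_)
open import Data.Sum using (_⊎_)
open import Relation.Binary.PropositionalEquality using (_≡_; _≢_)
open import Relation.Nullary using (¬_)
open import Function.Bundles using (_⇔_)

module _ (r : ℕ) .{{_ : NonZero r}} where

  Zr : Set
  Zr = Fin r

  ⟦_⟧ : ℕ → Zr
  ⟦ n ⟧ = n mod r

  infixl 6 _⊕_
  _⊕_ : Zr → Zr → Zr
  a ⊕ b = (toℕ a + toℕ b) mod r

  Interval : ℕ → ℕ → Zr → Set
  Interval a b x = a ≤ toℕ x × toℕ x ≤ b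

  Translate : Subset r → Zr → Zr → Set
  Translate A w y = ∃ λ a → a ∈ A × y ≡ a ⊕ w

  UnionTr : Subset r → Subset r → Zr → Set
  UnionTr A S y = ∃ λ s → s ∈ S × Translate A s y

  _⊑_ : (Zr → Set) → (Zr → Set) → Set
  X ⊑ Y = ∀ y → X y → Y y

  PointedMinimalCover : Subset r → Zr → Zr → Subset r → Set
  PointedMinimalCover A w₀ w₁ S₀ =
      2 ≤ ∣ S₀ ∣
    × w₁ ∈ S₀
    × (∀ (S₁ : Subset r) → S₁ ⊆ S₀ →
         (Translate A w₀ ⊑ UnionTr A S₁) ⇔ (S₁ ≡ S₀))
    × ¬ (Translate A w₁ ⊑
          (λ y → ∃ λ w → ((w ∈ S₀ × w ≢ w₁) ⊎ w ≡ w₀) × Translate A w y))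

-- A + w is covered by the translates of A by the candidates w + k and w − d (1 ≤ d ≤ k),
-- because a + w = 0 + (w + k) for a = k and a + w = k + (w − (k − a)) for a < k; take a
-- minimal subcover S₀ of the candidates. Write points as w + c with the offset c determined
-- modulo r: since 3k < r, the offsets that could make two such descriptions agree always lie
-- in a window shorter than r, so they cannot. Hence k + w ∈ A + s for a candidate s only when
-- s = w + k, which forces w + k ∈ S₀; w ∉ A + (w + k), so S₀ has a second element; and
-- 2k + w ∈ A + (w + k) lies neither in A + w nor in any A + (w − d), which is irreducibility.
module Submission where

open import Defs
open import Data.Nat using (ℕ; _≤_; _<_; _*_; NonZero)
open import Data.Nat.Coprimality using (Coprime)
open import Data.Fin.Subset using (Subset; _∈_; _⊆_; ∣_∣)
open import Data.Product using (∃; _×_)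

open import Data.Bool using (true)
open import Data.Empty using (⊥-elim)
open import Data.Fin using (Fin; toℕ; fromℕ<)
open import Data.Fin.Properties using (_≟_; any?; all?; toℕ<n; toℕ-fromℕ<; toℕ-injective)
open import Data.Fin.Subset using (_⊂_; _-_)
open import Data.Fin.Subset.Induction using (Acc; acc; ⊂-wellFounded)
open import Data.Fin.Subset.Properties using (_∈?_; ⊆-antisym; p⊂q⇒p⊆q; x∈p⇒p-x⊂p; x∈p∧x≢y⇒x∈p-y; x∈p⇒∣p-x∣<∣p∣)
open import Data.Nat using (suc; _+_; _∸_; _%_; _/_; z≤n; s≤s; >-nonZero)
open import Data.Nat.DivMod using (m≡m%n+[m/n]*n; %-distribˡ-+; m%n%n≡m%n; [m+n]%n≡m%n; m<n⇒m%n≡m)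
open import Data.Nat.Divisibility using (_∣_; divides; n∣m*n; ∣m+n∣m⇒∣n; >⇒∤)
open import Data.Nat.Properties using (+-assoc; +-comm; +-identityʳ; +-cancelˡ-≡; ≤-refl; ≤-trans; ≤-<-trans; <-≤-trans; <⇒≤; m≤m+n; m≤n+m; m<m+n; +-monoˡ-≤; +-monoʳ-≤; +-monoʳ-<; +-mono-≤-<; m≤n⇒m<n∨m≡n; m<n⇒0<n∸m; m<n+o⇒m∸n<o; m+n≤o⇒m≤o∸n; m+[n∸m]≡n; m∸n+n≡m)
open import Data.Product using (_,_; proj₁; proj₂)
open import Data.Sum using (_⊎_; inj₁; inj₂)
open import Data.Vec using (tabulate)
open import Data.Vec.Properties using (lookup∘tabulate; []=⇒lookup; lookup⇒[]=)
open import Function using (_∘_; id)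
open import Function.Bundles using (_⇔_; mk⇔)
open import Level using (0ℓ)
open import Relation.Binary.PropositionalEquality using (_≡_; _≢_; refl; sym; trans; cong; cong₂; subst; module ≡-Reasoning)
open import Relation.Nullary using (¬_; yes; no; does; proof)
open import Relation.Nullary.Decidable using (dec-true; _×-dec_; _⊎-dec_; _→-dec_)
open import Relation.Nullary.Reflects using (Reflects; invert)
open import Relation.Unary using (Pred; Decidable)

[m+n%d]%d≡[m+n]%d : ∀ m n d .{{_ : NonZero d}} → (m + n % d) % d ≡ (m + n) % d
[m+n%d]%d≡[m+n]%d m n d = begin
  (m + n % d) % d          ≡⟨ %-distribˡ-+ m (n % d) d ⟩
  (m % d + n % d % d) % d  ≡⟨ cong (λ x → (m % d + x) % d) (m%n%n≡m%n n d) ⟩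
  (m % d + n % d) % d      ≡⟨ %-distribˡ-+ m n d ⟨
  (m + n) % d              ∎
  where open ≡-Reasoning

[m+n]%d≡m%d⇒d∣n : ∀ m n d .{{_ : NonZero d}} → (m + n) % d ≡ m % d → d ∣ n
[m+n]%d≡m%d⇒d∣n m n d eq =
  ∣m+n∣m⇒∣n (divides ((m + n) / d) (+-cancelˡ-≡ (m % d) _ _ (begin
    m % d + (m / d * d + n)  ≡⟨ +-assoc (m % d) _ n ⟨
    m % d + m / d * d + n    ≡⟨ cong (_+ n) (m≡m%n+[m/n]*n m d) ⟨
    m + n                    ≡⟨ m≡m%n+[m/n]*n (m + n) d ⟩
    (m + n) % d + (m + n) / d * d  ≡⟨ cong (_+ (m + n) / d * d) eq ⟩
    m % d + (m + n) / d * d  ∎)))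
    (n∣m*n (m / d))
  where open ≡-Reasoning

x∈p∧y∈p∧y≢x⇒2≤∣p∣ : ∀ {n} {p : Subset n} {x y} → x ∈ p → y ∈ p → y ≢ x → 2 ≤ ∣ p ∣
x∈p∧y∈p∧y≢x⇒2≤∣p∣ x∈p y∈p y≢x = ≤-trans
  (s≤s (≤-trans (s≤s z≤n) (x∈p⇒∣p-x∣<∣p∣ (x∈p∧x≢y⇒x∈p-y y∈p y≢x))))
  (x∈p⇒∣p-x∣<∣p∣ x∈p)

subset : ∀ {n} {P : Pred (Fin n) 0ℓ} → Decidable P → Subset n
subset P? = tabulate (does ∘ P?)

∈-subset⁺ : ∀ {n} {P : Pred (Fin n) 0ℓ} (P? : Decidable P) {x} → P x → x ∈ subset P?
∈-subset⁺ P? {x} px = lookup⇒[]= x _ (trans (lookup∘tabulate (does ∘ P?) x) (dec-true (P? x) px))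

∈-subset⁻ : ∀ {n} {P : Pred (Fin n) 0ℓ} (P? : Decidable P) {x} → x ∈ subset P? → P x
∈-subset⁻ {P = P} P? {x} x∈ = invert (subst (Reflects (P x)) does≡true (proof (P? x)))
  where
  does≡true : does (P? x) ≡ true
  does≡true = trans (sym (lookup∘tabulate (does ∘ P?) x)) ([]=⇒lookup x∈)

Minimal : ∀ {n} → Pred (Subset n) 0ℓ → Subset n → Set
Minimal P S = P S × (∀ S₁ → S₁ ⊆ S → P S₁ → S₁ ≡ S)

minimal⇔≡ : ∀ {n} {P : Pred (Subset n) 0ℓ} {S₀} → Minimal P S₀ →
            ∀ S₁ → S₁ ⊆ S₀ → P S₁ ⇔ S₁ ≡ S₀
minimal⇔≡ (pS₀ , minimal) S₁ S₁⊆S₀ = mk⇔ (minimal S₁ S₁⊆S₀) λ { refl → pS₀ }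

module _ {n : ℕ} {P : Pred (Subset n) 0ℓ} (P? : Decidable P)
         (P-mono : ∀ {S S′} → S ⊆ S′ → P S → P S′) where

  ∃-minimal-⊆ : ∀ {S} → P S → ∃ λ S₀ → S₀ ⊆ S × Minimal P S₀
  ∃-minimal-⊆ {S} = descend S (⊂-wellFounded S)
    where
    descend : ∀ S → Acc _⊂_ S → P S → ∃ λ S₀ → S₀ ⊆ S × Minimal P S₀
    descend S (acc rec) pS with any? (λ i → (i ∈? S) ×-dec P? (S - i))
    ... | yes (i , i∈S , pS-i) =
      let S₀ , S₀⊆S-i , min = descend (S - i) (rec S-i⊂S) pS-i
      in  S₀ , p⊂q⇒p⊆q S-i⊂S ∘ S₀⊆S-i , min
      where S-i⊂S = x∈p⇒p-x⊂p i∈S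
    ... | no irremovable = S , id , pS , λ S₁ S₁⊆S pS₁ → ⊆-antisym S₁⊆S (S⊆ S₁⊆S pS₁)
      where
      S⊆ : ∀ {S₁} → S₁ ⊆ S → P S₁ → S ⊆ S₁
      S⊆ {S₁} S₁⊆S pS₁ {i} i∈S with i ∈? S₁
      ... | yes i∈S₁ = i∈S₁
      ... | no  i∉S₁ = ⊥-elim (irremovable (i , i∈S , P-mono S₁⊆S-i pS₁))
        where
        S₁⊆S-i : S₁ ⊆ S - i
        S₁⊆S-i x∈S₁ = x∈p∧x≢y⇒x∈p-y (S₁⊆S x∈S₁) λ { refl → i∉S₁ x∈S₁ }

module _ (r : ℕ) .{{_ : NonZero r}} where

  toℕ-⊕ : ∀ a b → toℕ (_⊕_ r a b) ≡ (toℕ a + toℕ b) % r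
  toℕ-⊕ a b = toℕ-fromℕ< _

  toℕ-⟦⟧ : ∀ {n} → n < r → toℕ (⟦ r ⟧ n) ≡ n
  toℕ-⟦⟧ n<r = trans (toℕ-fromℕ< _) (m<n⇒m%n≡m n<r)

  module _ (A : Subset r) where

    Translate? : ∀ v → Decidable (Translate r A v)
    Translate? v y = any? λ a → (a ∈? A) ×-dec (y ≟ _⊕_ r a v)

    UnionTr? : ∀ S → Decidable (UnionTr r A S)
    UnionTr? S y = any? λ s → (s ∈? S) ×-dec Translate? s y

    UnionTr-mono : ∀ {S S′} → S ⊆ S′ → ∀ {y} → UnionTr r A S y → UnionTr r A S′ y
    UnionTr-mono S⊆S′ (s , s∈S , y∈A+s) = s , S⊆S′ s∈S , y∈A+s

-- y ≡w+ c says y = w + c̄ in ℤ/rℤ; the offset c is only determined modulo r.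
module Offset (r : ℕ) .{{_ : NonZero r}} (w : Zr r) where

  infix 4 _≡w+_
  _≡w+_ : Zr r → ℕ → Set
  y ≡w+ c = toℕ y ≡ (toℕ w + c) % r

  ⊕w-≡w+ : ∀ a → _⊕_ r a w ≡w+ toℕ a
  ⊕w-≡w+ a = trans (toℕ-⊕ r a w) (cong (_% r) (+-comm (toℕ a) (toℕ w)))

  w⊕⟦⟧-≡w+ : ∀ c → _⊕_ r w (⟦ r ⟧ c) ≡w+ c
  w⊕⟦⟧-≡w+ c = trans (toℕ-⊕ r w _) (trans (cong (λ x → (toℕ w + x) % r) (toℕ-fromℕ< _))
                                            ([m+n%d]%d≡[m+n]%d (toℕ w) c r))

  ⊕-≡w+ : ∀ a {y c} → y ≡w+ c → _⊕_ r a y ≡w+ toℕ a + c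
  ⊕-≡w+ a {y} {c} y≡w+c = begin
    toℕ (_⊕_ r a y)              ≡⟨ toℕ-⊕ r a y ⟩
    (toℕ a + toℕ y) % r          ≡⟨ cong (λ x → (toℕ a + x) % r) y≡w+c ⟩
    (toℕ a + (toℕ w + c) % r) % r ≡⟨ [m+n%d]%d≡[m+n]%d (toℕ a) _ r ⟩
    (toℕ a + (toℕ w + c)) % r    ≡⟨ cong (_% r) (+-comm (toℕ a) _) ⟩
    (toℕ w + c + toℕ a) % r      ≡⟨ cong (_% r) (+-assoc (toℕ w) c (toℕ a)) ⟩
    (toℕ w + (c + toℕ a)) % r    ≡⟨ cong (λ x → (toℕ w + x) % r) (+-comm c (toℕ a)) ⟩
    (toℕ w + (toℕ a + c)) % r    ∎
    where open ≡-Reasoning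

  ⟦⟧⊕-≡w+ : ∀ {n y c} → n < r → y ≡w+ c → _⊕_ r (⟦ r ⟧ n) y ≡w+ n + c
  ⟦⟧⊕-≡w+ {n} {y} {c} n<r y≡w+c =
    subst (λ m → _⊕_ r (⟦ r ⟧ n) y ≡w+ m + c) (toℕ-⟦⟧ r n<r) (⊕-≡w+ (⟦ r ⟧ n) y≡w+c)

  ⟦⟧⊕w-≡w+ : ∀ {n} → n < r → _⊕_ r (⟦ r ⟧ n) w ≡w+ n
  ⟦⟧⊕w-≡w+ {n} n<r = subst (_⊕_ r (⟦ r ⟧ n) w ≡w+_) (toℕ-⟦⟧ r n<r) (⊕w-≡w+ (⟦ r ⟧ n))

  ≡w+-+r : ∀ {y c} → y ≡w+ c → y ≡w+ c + r
  ≡w+-+r {y} {c} y≡w+c = trans y≡w+c (trans (sym ([m+n]%n≡m%n (toℕ w + c) r))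
                                             (cong (_% r) (+-assoc (toℕ w) c r)))

  ≡w+-injective : ∀ {y y′ c} → y ≡w+ c → y′ ≡w+ c → y ≡ y′
  ≡w+-injective y≡w+c y′≡w+c = toℕ-injective (trans y≡w+c (sym y′≡w+c))

  ≡w+-window : ∀ {y y′ c₁ c₂} → y ≡w+ c₁ → y′ ≡w+ c₂ → c₁ < c₂ → c₂ < c₁ + r → y ≢ y′
  ≡w+-window {c₁ = c₁} {c₂} y≡w+c₁ y′≡w+c₂ c₁<c₂ c₂<c₁+r refl =
    >⇒∤ {{>-nonZero (m<n⇒0<n∸m c₁<c₂)}} (m<n+o⇒m∸n<o c₂ c₁ c₂<c₁+r) r∣c₂∸c₁
    where
    open ≡-Reasoning
    r∣c₂∸c₁ : r ∣ c₂ ∸ c₁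
    r∣c₂∸c₁ = [m+n]%d≡m%d⇒d∣n (toℕ w + c₁) (c₂ ∸ c₁) r (begin
      (toℕ w + c₁ + (c₂ ∸ c₁)) % r  ≡⟨ cong (_% r) (+-assoc (toℕ w) c₁ _) ⟩
      (toℕ w + (c₁ + (c₂ ∸ c₁))) % r ≡⟨ cong (λ c → (toℕ w + c) % r) (m+[n∸m]≡n (<⇒≤ c₁<c₂)) ⟩
      (toℕ w + c₂) % r               ≡⟨ trans (sym y′≡w+c₂) y≡w+c₁ ⟩
      (toℕ w + c₁) % r               ∎)

module Cover (r k : ℕ) .{{_ : NonZero r}} (1≤k : 1 ≤ k) (3k<r : 3 * k < r)
  (A : Subset r) (0∈A : ⟦ r ⟧ 0 ∈ A) (k∈A : ⟦ r ⟧ k ∈ A)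
  (A⊆[0,k] : ∀ x → x ∈ A → Interval r 0 k x) (w : Zr r) where

  open Offset r w

  k<r : k < r
  k<r = ≤-<-trans (m≤m+n k _) 3k<r

  k+k<r : k + k < r
  k+k<r = ≤-<-trans (+-monoʳ-≤ k (m≤m+n k _)) 3k<r

  ∈A⇒≤k : ∀ {a} → a ∈ A → toℕ a ≤ k
  ∈A⇒≤k a∈A = proj₂ (A⊆[0,k] _ a∈A)

  w₁ : Zr r
  w₁ = _⊕_ r w (⟦ r ⟧ k)

  -- lower j = w − (k − j)
  lower : Fin k → Zr r
  lower j = _⊕_ r w (⟦ r ⟧ (r ∸ k + toℕ j))

  k+k<lower-offset : (j : Fin k) → k + k < r ∸ k + toℕ j
  k+k<lower-offset j = <-≤-trans (m+n≤o⇒m≤o∸n (suc (k + k)) 3k+1≤r) (m≤m+n (r ∸ k) (toℕ j))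
    where
    3k+1≤r : suc (k + k + k) ≤ r
    3k+1≤r = subst (λ m → suc m ≤ r) (trans (cong (λ m → k + (k + m)) (+-identityʳ k))
                                             (sym (+-assoc k k k))) 3k<r

  lower-offset<r : (j : Fin k) → r ∸ k + toℕ j < r
  lower-offset<r j = subst (r ∸ k + toℕ j <_) (m∸n+n≡m (<⇒≤ k<r)) (+-monoʳ-< (r ∸ k) (toℕ<n j))

  IsCandidate : Pred (Zr r) 0ℓ
  IsCandidate s = s ≡ w₁ ⊎ ∃ λ j → s ≡ lower j

  candidate? : Decidable IsCandidate
  candidate? s = (s ≟ w₁) ⊎-dec any? (λ j → s ≟ lower j)

  candidates : Subset r
  candidates = subset candidate?

  Covers : Pred (Subset r) 0ℓ
  Covers S = _⊑_ r (Translate r A w) (UnionTr r A S)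

  covers? : Decidable Covers
  covers? S = all? λ y → Translate? r A w y →-dec UnionTr? r A S y

  covers-mono : ∀ {S S′} → S ⊆ S′ → Covers S → Covers S′
  covers-mono S⊆S′ S-covers y y∈A+w = UnionTr-mono r A S⊆S′ (S-covers y y∈A+w)

  candidates-covers : Covers candidates
  candidates-covers y (a , a∈A , refl) with m≤n⇒m<n∨m≡n (∈A⇒≤k a∈A)
  ... | inj₂ a≡k = w₁ , ∈-subset⁺ candidate? (inj₁ refl) , ⟦ r ⟧ 0 , 0∈A ,
    ≡w+-injective (subst (_ ≡w+_) a≡k (⊕w-≡w+ a)) (⟦⟧⊕-≡w+ (≤-<-trans z≤n k<r) (w⊕⟦⟧-≡w+ k))
  ... | inj₁ a<k = lower j , ∈-subset⁺ candidate? (inj₂ (j , refl)) , ⟦ r ⟧ k , k∈A ,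
    ≡w+-injective (≡w+-+r (⊕w-≡w+ a)) (subst (_⊕_ r (⟦ r ⟧ k) (lower j) ≡w+_) offset≡
                                                (⟦⟧⊕-≡w+ k<r (w⊕⟦⟧-≡w+ (r ∸ k + toℕ j))))
    where
    open ≡-Reasoning
    j = fromℕ< a<k
    offset≡ : k + (r ∸ k + toℕ j) ≡ toℕ a + r
    offset≡ = begin
      k + (r ∸ k + toℕ j)  ≡⟨ +-assoc k (r ∸ k) (toℕ j) ⟨
      k + (r ∸ k) + toℕ j  ≡⟨ cong₂ _+_ (m+[n∸m]≡n (<⇒≤ k<r)) (toℕ-fromℕ< a<k) ⟩
      r + toℕ a            ≡⟨ +-comm r (toℕ a) ⟩
      toℕ a + r            ∎

  lower-misses : ∀ {y c} (j : Fin k) → y ≡w+ c → k ≤ c → c ≤ k + k → ¬ Translate r A (lower j) y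
  lower-misses j y≡w+c k≤c c≤k+k (a , a∈A , y≡a⊕lower) =
    ≡w+-window y≡w+c (⊕-≡w+ a (w⊕⟦⟧-≡w+ (r ∸ k + toℕ j)))
      (≤-<-trans c≤k+k (<-≤-trans (k+k<lower-offset j) (m≤n+m _ (toℕ a))))
      (<-≤-trans (+-mono-≤-< (∈A⇒≤k a∈A) (lower-offset<r j)) (+-monoˡ-≤ r k≤c))
      y≡a⊕lower

  only-w₁-covers : ∀ {y c s} → y ≡w+ c → k ≤ c → c ≤ k + k →
                   s ∈ candidates → Translate r A s y → s ≡ w₁
  only-w₁-covers y≡w+c k≤c c≤k+k s∈cands y∈A+s with ∈-subset⁻ candidate? s∈cands
  ... | inj₁ s≡w₁ = s≡w₁
  ... | inj₂ (j , refl) = ⊥-elim (lower-misses j y≡w+c k≤c c≤k+k y∈A+s)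

  w₁-misses-w : ¬ Translate r A w₁ (_⊕_ r (⟦ r ⟧ 0) w)
  w₁-misses-w (a , a∈A , w≡a⊕w₁) =
    ≡w+-window (⟦⟧⊕w-≡w+ (≤-<-trans z≤n k<r)) (⊕-≡w+ a (w⊕⟦⟧-≡w+ k))
      (<-≤-trans 1≤k (m≤n+m k (toℕ a)))
      (≤-<-trans (+-monoˡ-≤ k (∈A⇒≤k a∈A)) k+k<r)
      w≡a⊕w₁

  k⊕w₁≡w+k+k : _⊕_ r (⟦ r ⟧ k) w₁ ≡w+ k + k
  k⊕w₁≡w+k+k = ⟦⟧⊕-≡w+ k<r (w⊕⟦⟧-≡w+ k)

  w-misses-k⊕w₁ : ¬ Translate r A w (_⊕_ r (⟦ r ⟧ k) w₁)
  w-misses-k⊕w₁ (a , a∈A , k⊕w₁≡a⊕w) =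
    ≡w+-window (⊕w-≡w+ a) k⊕w₁≡w+k+k
      (≤-<-trans (∈A⇒≤k a∈A) (m<m+n k 1≤k))
      (<-≤-trans k+k<r (m≤n+m r (toℕ a)))
      (sym k⊕w₁≡a⊕w)

  module _ {S₀ : Subset r} (S₀⊆cands : S₀ ⊆ candidates) where

    w₁∈S₀ : Covers S₀ → w₁ ∈ S₀
    w₁∈S₀ S₀-covers with S₀-covers _ (⟦ r ⟧ k , k∈A , refl)
    ... | s , s∈S₀ , k⊕w∈A+s =
      subst (_∈ S₀) (only-w₁-covers (⟦⟧⊕w-≡w+ k<r) ≤-refl (m≤m+n k k) (S₀⊆cands s∈S₀) k⊕w∈A+s)
            s∈S₀

    2≤∣S₀∣ : Covers S₀ → 2 ≤ ∣ S₀ ∣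
    2≤∣S₀∣ S₀-covers with S₀-covers _ (⟦ r ⟧ 0 , 0∈A , refl)
    ... | s , s∈S₀ , w∈A+s =
      x∈p∧y∈p∧y≢x⇒2≤∣p∣ (w₁∈S₀ S₀-covers) s∈S₀ λ { refl → w₁-misses-w w∈A+s }

    irreducible : ¬ (_⊑_ r (Translate r A w₁)
                       (λ y → ∃ λ v → ((v ∈ S₀ × v ≢ w₁) ⊎ v ≡ w) × Translate r A v y))
    irreducible covered with covered _ (⟦ r ⟧ k , k∈A , refl)
    ... | v , inj₁ (v∈S₀ , v≢w₁) , k⊕w₁∈A+v =
      v≢w₁ (only-w₁-covers k⊕w₁≡w+k+k (m≤m+n k k) ≤-refl (S₀⊆cands v∈S₀) k⊕w₁∈A+v)
    ... | v , inj₂ refl , k⊕w₁∈A+w = w-misses-k⊕w₁ k⊕w₁∈A+w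

proposition2 : (r k : ℕ) .{{_ : NonZero r}} → Coprime r k → 1 ≤ k → 3 * k < r →
    (A : Subset r) → ⟦ r ⟧ 0 ∈ A → ⟦ r ⟧ k ∈ A →
    (∀ x → x ∈ A → Interval r 0 k x) →
    (w : Zr r) → ∃ λ (S₀ : Subset r) →
      2 ≤ ∣ S₀ ∣ × _⊕_ r w (⟦ r ⟧ k) ∈ S₀ ×
      PointedMinimalCover r A w (_⊕_ r w (⟦ r ⟧ k)) S₀
proposition2 r k _ 1≤k 3k<r A 0∈A k∈A A⊆[0,k] w =
  let S₀ , S₀⊆cands , S₀-minimal = ∃-minimal-⊆ covers? covers-mono candidates-covers
      S₀-covers = proj₁ S₀-minimal
  in  S₀ , 2≤∣S₀∣ S₀⊆cands S₀-covers , w₁∈S₀ S₀⊆cands S₀-covers ,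
      2≤∣S₀∣ S₀⊆cands S₀-covers , w₁∈S₀ S₀⊆cands S₀-covers ,
      minimal⇔≡ S₀-minimal , irreducible S₀⊆cands
  where open Cover r k 1≤k 3k<r A 0∈A k∈A A⊆[0,k] w
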